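{- The minimal DFA solving the promise problem $A^{N}=(A_{yes}^{N},A_{no}^{N})$ exactly has $2^{k+1}$ states.
   Context: Let $k,l>0$ be integers and $N=2^{k}(2l+1)$. Let $A_{yes}^{N}=\{a^{iN} \mid i \text{ is a nonnegative even integer}\}$ and $A_{no}^{N}=\{a^{iN} \mid i \text{ is a positive odd integer}\}$ over $\Sigma=\{a\}$. A promise problem $(A_{yes},A_{no})$ is solved exactly by a machine if every string in $A_{yes}$ is accepted and every string in $A_{no}$ is rejected. A DFA here is a realtime deterministic finite automaton reading the input $\text{¢}w\$$ (¢ and $\$$ being the left- and right-end markers), moving its head one square right each step and stopping after reading $\$$. -}

module Defs where

open import Data.Nat using (ℕ; zero; suc; _+_; _*_; _^_; _≤_)
open import Data.Fin using (Fin)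
open import Data.Bool using (Bool; true; false)
open import Data.List using (List; []; _∷_; replicate)
open import Data.Product using (Σ; ∃; _×_)
open import Relation.Binary.PropositionalEquality using (_≡_)

data Letter : Set where
  a : Letter

data TapeSym : Set where
  cent   : TapeSym
  letter : Letter → TapeSym
  dollar : TapeSym

record DFA (n : ℕ) : Set where
  field
    start  : Fin n
    δ      : Fin n → TapeSym → Fin n
    accept : Fin n → Bool

open DFA public

runWord : ∀ {n} → DFA n → Fin n → List Letter → Fin n
runWord M q []       = q
runWord M q (x ∷ xs) = runWord M (δ M q (letter x)) xs

finalState : ∀ {n} → DFA n → List Letter → Fin n
finalState M w = δ M (runWord M (δ M (start M) cent) w) dollar

Accepts : ∀ {n} → DFA n → List Letter → Set
Accepts M w = accept M (finalState M w) ≡ true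

Rejects : ∀ {n} → DFA n → List Letter → Set
Rejects M w = accept M (finalState M w) ≡ false

record PromiseProblem : Set₁ where
  field
    yes : List Letter → Set
    no  : List Letter → Set

open PromiseProblem public

SolvesExactly : ∀ {n} → DFA n → PromiseProblem → Set
SolvesExactly M P = (∀ w → yes P w → Accepts M w) × (∀ w → no P w → Rejects M w)

A : ℕ → PromiseProblem
A N = record
  { yes = λ w → ∃ λ j → w ≡ replicate ((2 * j) * N) a
  ; no  = λ w → ∃ λ j → w ≡ replicate ((2 * j + 1) * N) a
  }

MinimalDFAStates : PromiseProblem → ℕ → Set
MinimalDFAStates P s =
  Σ (DFA s) (λ M → SolvesExactly M P) ×
  (∀ m (M : DFA m) → SolvesExactly M P → s ≤ m)

module Submission where

-- Upper bound: counting input length modulo 2^(k+1) suffices, since yes-instances have length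
-- ≡ 0 and no-instances length ≡ 2^k modulo 2^(k+1).
-- Lower bound: among the states reached after ¢a^0, …, ¢a^m in an m-state DFA two coincide, say
-- after ¢a^x and ¢a^(x+d) with 0 < d ≤ m, so from then on the run is d-periodic. If d < 2^(k+1),
-- then some multiple of d is an odd multiple of 2^k (halve d until it is odd), hence some
-- multiple of d is an odd multiple of N; adding it to the yes-length 2xN yields a no-length
-- reaching the same state, which is impossible.

open import Defs
open import Data.Nat using (ℕ; suc; _+_; _*_; _^_; _<_)
open import Data.Nat.Base using (zero; _≤_; _∸_; NonZero; >-nonZero; _≡ᵇ_; z<s; s<s)
open import Data.Nat.Properties
open import Data.Nat.DivMod using (_%_; _mod_; %-distribˡ-+; m%n%n≡m%n; m*n%n≡0; [m+kn]%n≡m%n; m<n⇒m%n≡m)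
open import Data.Nat.Tactic.RingSolver using (solve-∀)
open import Data.Fin using (Fin; toℕ)
open import Data.Fin.Properties using (pigeonhole; toℕ<n; toℕ-fromℕ<)
open import Data.Bool using (Bool; true; false)
open import Data.List using (replicate)
open import Data.Product using (∃; ∃₂; _,_)
open import Data.Sum using (_⊎_; inj₁; inj₂)
open import Relation.Binary.PropositionalEquality

[m%n+t]%n≡[m+t]%n : ∀ m t n .{{_ : NonZero n}} → (m % n + t) % n ≡ (m + t) % n
[m%n+t]%n≡[m+t]%n m t n = begin
  (m % n + t) % n          ≡⟨ %-distribˡ-+ (m % n) t n ⟩
  (m % n % n + t % n) % n  ≡⟨ cong (λ z → (z + t % n) % n) (m%n%n≡m%n m n) ⟩
  (m % n + t % n) % n      ≡⟨ %-distribˡ-+ m t n ⟨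
  (m + t) % n              ∎
  where open ≡-Reasoning

module Counter (n : ℕ) .{{_ : NonZero n}} where

  counter : DFA n
  counter = record
    { start  = 0 mod n
    ; δ      = λ { _ cent → 0 mod n ; q (letter a) → (toℕ q + 1) mod n ; q dollar → q }
    ; accept = λ q → toℕ q ≡ᵇ 0
    }

  counter-run : ∀ q t → toℕ (runWord counter q (replicate t a)) ≡ (toℕ q + t) % n
  counter-run q zero = trans (sym (m<n⇒m%n≡m (toℕ<n q))) (cong (_% n) (sym (+-identityʳ (toℕ q))))
  counter-run q (suc t) = begin
    toℕ (runWord counter ((toℕ q + 1) mod n) (replicate t a)) ≡⟨ counter-run ((toℕ q + 1) mod n) t ⟩
    (toℕ ((toℕ q + 1) mod n) + t) % n                          ≡⟨ cong (λ z → (z + t) % n) (toℕ-fromℕ< _) ⟩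
    ((toℕ q + 1) % n + t) % n                                   ≡⟨ [m%n+t]%n≡[m+t]%n (toℕ q + 1) t n ⟩
    (toℕ q + 1 + t) % n                                         ≡⟨ cong (_% n) (+-assoc (toℕ q) 1 t) ⟩
    (toℕ q + suc t) % n                                         ∎
    where open ≡-Reasoning

  counter-final : ∀ t → toℕ (finalState counter (replicate t a)) ≡ t % n
  counter-final t = begin
    toℕ (finalState counter (replicate t a)) ≡⟨ counter-run (0 mod n) t ⟩
    (toℕ (0 mod n) + t) % n                  ≡⟨ cong (λ z → (z + t) % n) (toℕ-fromℕ< _) ⟩
    (0 % n + t) % n                          ≡⟨ [m%n+t]%n≡[m+t]%n 0 t n ⟩
    t % n                                    ∎
    where open ≡-Reasoning

  counter-accepts : ∀ t → t % n ≡ 0 → Accepts counter (replicate t a)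
  counter-accepts t t%n≡0 rewrite counter-final t | t%n≡0 = refl

  counter-rejects : ∀ t → 0 < t % n → Rejects counter (replicate t a)
  counter-rejects t 0<t%n rewrite counter-final t with t % n | 0<t%n
  ... | suc _ | _ = refl

upperBound : ∀ k l → ∃ λ (M : DFA (2 ^ suc k)) → SolvesExactly M (A (2 ^ k * (2 * l + 1)))
upperBound k l = counter , yes-accepted , no-rejected
  where
  instance
    2^[1+k]≢0 : NonZero (2 ^ suc k)
    2^[1+k]≢0 = m^n≢0 2 (suc k)
  open Counter (2 ^ suc k)
  N = 2 ^ k * (2 * l + 1)

  yes-length : ∀ j p l → 2 * j * (p * (2 * l + 1)) ≡ j * (2 * l + 1) * (2 * p)
  yes-length = solve-∀

  no-length : ∀ j p l → (2 * j + 1) * (p * (2 * l + 1)) ≡ p + (j * (2 * l + 1) + l) * (2 * p)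
  no-length = solve-∀

  yes-accepted : ∀ w → yes (A N) w → Accepts counter w
  yes-accepted _ (j , refl) = counter-accepts _ (begin
    2 * j * N % 2 ^ suc k                   ≡⟨ cong (_% 2 ^ suc k) (yes-length j (2 ^ k) l) ⟩
    j * (2 * l + 1) * 2 ^ suc k % 2 ^ suc k ≡⟨ m*n%n≡0 (j * (2 * l + 1)) (2 ^ suc k) ⟩
    0                                       ∎)
    where open ≡-Reasoning

  no-rejected : ∀ w → no (A N) w → Rejects counter w
  no-rejected _ (j , refl) = counter-rejects _ (subst (0 <_) (sym (begin
    (2 * j + 1) * N % 2 ^ suc k                                ≡⟨ cong (_% 2 ^ suc k) (no-length j (2 ^ k) l) ⟩
    (2 ^ k + (j * (2 * l + 1) + l) * 2 ^ suc k) % 2 ^ suc k    ≡⟨ [m+kn]%n≡m%n (2 ^ k) (j * (2 * l + 1) + l) (2 ^ suc k) ⟩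
    2 ^ k % 2 ^ suc k                                          ≡⟨ m<n⇒m%n≡m (^-monoʳ-< 2 (s<s z<s) (n<1+n k)) ⟩
    2 ^ k                                                      ∎)) (m^n>0 2 k))
    where open ≡-Reasoning

even⊎odd : ∀ n → ∃ (λ h → n ≡ 2 * h) ⊎ ∃ (λ h → n ≡ 2 * h + 1)
even⊎odd zero = inj₁ (0 , refl)
even⊎odd (suc n) with even⊎odd n
... | inj₁ (h , refl) = inj₂ (h , +-comm 1 (2 * h))
... | inj₂ (h , refl) = inj₁ (suc h , 1+[2h+1]≡2[1+h] h)
  where
  1+[2h+1]≡2[1+h] : ∀ h → suc (2 * h + 1) ≡ 2 * suc h
  1+[2h+1]≡2[1+h] = solve-∀

multiple≡odd*2^ : ∀ k d → 0 < d → d < 2 ^ suc k → ∃₂ λ c r → c * d ≡ (2 * r + 1) * 2 ^ k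
multiple≡odd*2^ zero (suc zero) _ _ = 1 , 0 , refl
multiple≡odd*2^ zero (suc (suc _)) _ (s<s (s<s ()))
multiple≡odd*2^ (suc k) d 0<d d<2^[2+k] with even⊎odd d
... | inj₂ (h , refl) = 2 ^ suc k , h , *-comm (2 ^ suc k) (2 * h + 1)
... | inj₁ (h , refl) with multiple≡odd*2^ k h (*-cancelˡ-< 2 0 h 0<d) (*-cancelˡ-< 2 h _ d<2^[2+k])
...   | c , r , ch≡odd*2^k = c , r , (begin
  c * (2 * h)               ≡⟨ x*[2y]≡2[xy] c h ⟩
  2 * (c * h)               ≡⟨ cong (2 *_) ch≡odd*2^k ⟩
  2 * ((2 * r + 1) * 2 ^ k) ≡⟨ x*[2y]≡2[xy] (2 * r + 1) (2 ^ k) ⟨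
  (2 * r + 1) * 2 ^ suc k   ∎)
  where
  open ≡-Reasoning
  x*[2y]≡2[xy] : ∀ x y → x * (2 * y) ≡ 2 * (x * y)
  x*[2y]≡2[xy] = solve-∀

module Run {m : ℕ} (M : DFA m) where

  stateAfter : ℕ → Fin m
  stateAfter t = runWord M (δ M (start M) cent) (replicate t a)

  runWord-replicate-+ : ∀ q x t →
    runWord M q (replicate (x + t) a) ≡ runWord M (runWord M q (replicate x a)) (replicate t a)
  runWord-replicate-+ q zero    t = refl
  runWord-replicate-+ q (suc x) t = runWord-replicate-+ (δ M q (letter a)) x t

  stateAfter-+ : ∀ {x y} → stateAfter x ≡ stateAfter y → ∀ t → stateAfter (x + t) ≡ stateAfter (y + t)
  stateAfter-+ {x} {y} x~y t = begin
    stateAfter (x + t)                                 ≡⟨ runWord-replicate-+ _ x t ⟩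
    runWord M (stateAfter x) (replicate t a)           ≡⟨ cong (λ q → runWord M q (replicate t a)) x~y ⟩
    runWord M (stateAfter y) (replicate t a)           ≡⟨ runWord-replicate-+ _ y t ⟨
    stateAfter (y + t)                                 ∎
    where open ≡-Reasoning

  stateAfter-period : ∀ {x d y} → stateAfter x ≡ stateAfter (x + d) → x ≤ y →
                      stateAfter y ≡ stateAfter (y + d)
  stateAfter-period {x} {d} period x≤y with m≤n⇒∃[o]m+o≡n x≤y
  ... | t , refl = trans (stateAfter-+ {x} {x + d} period t) (cong stateAfter (x+d+t≡x+t+d x d t))
    where
    x+d+t≡x+t+d : ∀ x d t → x + d + t ≡ x + t + d
    x+d+t≡x+t+d = solve-∀

  stateAfter-periodic : ∀ {x d y} → stateAfter x ≡ stateAfter (x + d) → x ≤ y →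
                        ∀ c → stateAfter y ≡ stateAfter (y + c * d)
  stateAfter-periodic {y = y} period x≤y zero = cong stateAfter (sym (+-identityʳ y))
  stateAfter-periodic {x} {d} {y} period x≤y (suc c) = begin
    stateAfter y                 ≡⟨ stateAfter-periodic period x≤y c ⟩
    stateAfter (y + c * d)       ≡⟨ stateAfter-period period (≤-trans x≤y (m≤m+n y (c * d))) ⟩
    stateAfter (y + c * d + d)   ≡⟨ cong stateAfter (y+cd+d≡y+[1+c]d y c d) ⟩
    stateAfter (y + suc c * d)   ∎
    where
    open ≡-Reasoning
    y+cd+d≡y+[1+c]d : ∀ y c d → y + c * d + d ≡ y + suc c * d
    y+cd+d≡y+[1+c]d = solve-∀

  period-no-odd-multiple : ∀ {N x d} .{{_ : NonZero N}} c r → SolvesExactly M (A N) →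
    stateAfter x ≡ stateAfter (x + d) → c * d ≢ (2 * r + 1) * N
  period-no-odd-multiple {N} {x} {d} c r (yes-accepted , no-rejected) period cd≡odd*N =
    true≢false (begin
      true                                                    ≡⟨ yes-accepted _ (x , refl) ⟨
      accept M (δ M (stateAfter (2 * x * N)) dollar)          ≡⟨ cong acceptFrom (stateAfter-periodic period x≤2xN c) ⟩
      accept M (δ M (stateAfter (2 * x * N + c * d)) dollar)  ≡⟨ cong (λ t → acceptFrom (stateAfter t)) shifted≡no-length ⟩
      accept M (δ M (stateAfter ((2 * (x + r) + 1) * N)) dollar) ≡⟨ no-rejected _ (x + r , refl) ⟩
      false ∎)
    where
    open ≡-Reasoning
    true≢false : true ≢ false
    true≢false ()
    acceptFrom : Fin m → Bool
    acceptFrom q = accept M (δ M q dollar)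
    x≤2xN : x ≤ 2 * x * N
    x≤2xN = ≤-trans (m≤n*m x 2) (m≤m*n (2 * x) N)
    shifted≡no-length : 2 * x * N + c * d ≡ (2 * (x + r) + 1) * N
    shifted≡no-length = trans (cong (2 * x * N +_) cd≡odd*N) (2xN+[2r+1]N≡[2[x+r]+1]N x r N)
      where
      2xN+[2r+1]N≡[2[x+r]+1]N : ∀ x r N → 2 * x * N + (2 * r + 1) * N ≡ (2 * (x + r) + 1) * N
      2xN+[2r+1]N≡[2[x+r]+1]N = solve-∀

  period≥2^[1+k] : ∀ k l {x d} → SolvesExactly M (A (2 ^ k * (2 * l + 1))) → 0 < d →
                   stateAfter x ≡ stateAfter (x + d) → 2 ^ suc k ≤ d
  period≥2^[1+k] k l {x} {d} solves 0<d period = ≮⇒≥ λ d<2^[1+k] →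
    let c , r , cd≡odd*2^k = multiple≡odd*2^ k d 0<d d<2^[1+k] in
    period-no-odd-multiple {x = x} {{N≢0}} (c * (2 * l + 1)) r solves period (begin
      c * (2 * l + 1) * d           ≡⟨ xyz≡y[xz] c (2 * l + 1) d ⟩
      (2 * l + 1) * (c * d)         ≡⟨ cong ((2 * l + 1) *_) cd≡odd*2^k ⟩
      (2 * l + 1) * ((2 * r + 1) * 2 ^ k) ≡⟨ x[yz]≡y[zx] (2 * l + 1) (2 * r + 1) (2 ^ k) ⟩
      (2 * r + 1) * (2 ^ k * (2 * l + 1)) ∎)
    where
    open ≡-Reasoning
    N≢0 : NonZero (2 ^ k * (2 * l + 1))
    N≢0 = m*n≢0 (2 ^ k) (2 * l + 1) {{m^n≢0 2 k}} {{>-nonZero (m≤n+m 1 (2 * l))}}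
    xyz≡y[xz] : ∀ x y z → x * y * z ≡ y * (x * z)
    xyz≡y[xz] = solve-∀
    x[yz]≡y[zx] : ∀ x y z → x * (y * z) ≡ y * (z * x)
    x[yz]≡y[zx] = solve-∀

lowerBound : ∀ k l m (M : DFA m) → SolvesExactly M (A (2 ^ k * (2 * l + 1))) → 2 ^ suc k ≤ m
lowerBound k l m M solves with pigeonhole (n<1+n m) (λ i → stateAfter (toℕ i))
  where open Run M
... | i , j , i<j , same = ≤-trans (period≥2^[1+k] k l {toℕ i} solves (m<n⇒0<n∸m i<j) period) d≤m
  where
  open Run M
  d≤m : toℕ j ∸ toℕ i ≤ m
  d≤m = ≤-trans (m∸n≤m (toℕ j) (toℕ i)) (≤-pred (toℕ<n j))
  period : stateAfter (toℕ i) ≡ stateAfter (toℕ i + (toℕ j ∸ toℕ i))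
  period = trans same (cong stateAfter (sym (m+[n∸m]≡n (<⇒≤ i<j))))

mainTheorem4 : (k l : ℕ) → 0 < k → 0 < l →
    MinimalDFAStates (A ((2 ^ k) * (2 * l + 1))) (2 ^ (suc k))
mainTheorem4 k l _ _ = upperBound k l , lowerBound k l
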